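{- Let $A$ be an $n\times m$ binary matrix and let $R$ denote either the binary rank or the boolean rank (with "base" and "spans" understood with respect to the same one of these two settings). Let $k=R(A)$. (i) If $A$ has a base that spans all other bases of $A$, then for every set of binary column vectors $x_1,\dots,x_t\in\{0,1\}^n$ such that $R(A|x_i)=k$ for every $1\le i\le t$, it also holds that $R(A|x_1,\dots,x_t)=k$. (ii) If there is no base of $A$ that spans all other bases of $A$, then there exist binary column vectors $x_1,\dots,x_t\in\{0,1\}^n$ such that $R(A|x_i)=k$ for every $1\le i\le t$, but $R(A|x_1,\dots,x_t)>k$. (Equivalently, $A$ has the Augmentation property for $R$ if and only if $A$ has a base spanning all other bases of $A$.)
   Context: A binary matrix is a matrix with entries in $\{0,1\}$. The binary rank $R_{binary}(A)$ of an $n\times m$ binary matrix $A$ is the minimal $k$ such that $A=U\cdot V$ with $U$ an $n\times k$ and $V$ a $k\times m$ binary matrix, where the product uses ordinary integer addition and multiplication. The boolean rank $R_{bool}(A)$ is defined the same way except that the product uses boolean arithmetic ($1+1=1$, i.e. entrywise OR of AND's). A set $X$ of binary vectors spans a set $Y$ of vectors (binary setting) if every $y\in Y$ is a sum, with ordinary addition, of a subset of the vectors of $X$ (i.e. a linear combination with coefficients in $\{0,1\}$); in the boolean setting the sum is the boolean sum (entrywise OR). A base of $A$ (in the given setting) is a set of binary vectors in $\{0,1\}^n$ spanning all columns of $A$, of minimum cardinality among all such spanning sets; its size equals the corresponding rank of $A$. $(A|x_1,\dots,x_t)$ denotes the matrix obtained by appending the column vectors $x_1,\dots,x_t$ to $A$.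 $A$ has the Augmentation property for a rank function $R$ if for any column vectors $x_1,\dots,x_t$ with $R(A|x_i)=R(A)$ for all $i$, also $R(A|x_1,\dots,x_t)=R(A)$. -}

module Defs where

open import Data.Nat using (ℕ; zero; suc; _+_; _≤_; _<_)
open import Data.Bool using (Bool; true; false; _∧_; _∨_)
open import Data.Vec using (Vec; []; _∷_; replicate; zipWith; map; lookup; _++_; [_])
open import Data.Fin using (Fin)
open import Data.Product using (Σ; ∃; _×_; _,_)
open import Relation.Binary.PropositionalEquality using (_≡_)

BVec : ℕ → Set
BVec n = Vec Bool n

-- An n × m binary matrix, stored as the vector of its m columns.
Matrix : ℕ → ℕ → Set
Matrix n m = Vec (BVec n) m

-- The two settings: ordinary integer arithmetic, or boolean arithmetic.
data Setting : Set where
  binary boolean : Setting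

bool→ℕ : Bool → ℕ
bool→ℕ false = 0
bool→ℕ true  = 1

combℕ : ∀ {n k} → Vec (BVec n) k → Vec Bool k → Vec ℕ n
combℕ {n} []      []       = replicate n 0
combℕ     (x ∷ X) (c ∷ cs) = zipWith _+_ (map (λ b → bool→ℕ (c ∧ b)) x) (combℕ X cs)

combB : ∀ {n k} → Vec (BVec n) k → Vec Bool k → Vec Bool n
combB {n} []      []       = replicate n false
combB     (x ∷ X) (c ∷ cs) = zipWith _∨_ (map (λ b → c ∧ b) x) (combB X cs)

Represents : Setting → ∀ {n k} → Vec (BVec n) k → Vec Bool k → BVec n → Set
Represents binary  X c y = combℕ X c ≡ map bool→ℕ y
Represents boolean X c y = combB X c ≡ y

SpansVec : Setting → ∀ {n k} → Vec (BVec n) k → BVec n → Set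
SpansVec s {k = k} X y = Σ (Vec Bool k) λ c → Represents s X c y

Spans : Setting → ∀ {n k m} → Vec (BVec n) k → Vec (BVec n) m → Set
Spans s {m = m} X Y = (j : Fin m) → SpansVec s X (lookup Y j)

-- A = U · V with U an n×k and V a k×m binary matrix (both stored by columns),
-- product taken in setting s: column j of U·V is the combination of the
-- columns of U with coefficients given by column j of V.
Factorizes : Setting → ∀ {n m} → Matrix n m → ℕ → Set
Factorizes s {n} {m} A k =
  Σ (Matrix n k) λ U → Σ (Matrix k m) λ V →
    (j : Fin m) → Represents s U (lookup V j) (lookup A j)

HasRank : Setting → ∀ {n m} → Matrix n m → ℕ → Set
HasRank s A k = Factorizes s A k × (∀ k' → Factorizes s A k' → k ≤ k')

IsBase : Setting → ∀ {n m k} → Matrix n m → Vec (BVec n) k → Set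
IsBase s {n} {k = k} A B =
  Spans s B A × (∀ k' (B' : Vec (BVec n) k') → Spans s B' A → k ≤ k')

HasUniversalBase : Setting → ∀ {n m} → Matrix n m → Set
HasUniversalBase s {n} A =
  Σ ℕ λ k → Σ (Vec (BVec n) k) λ B → IsBase s A B ×
    (∀ k' (B' : Vec (BVec n) k') → IsBase s A B' → Spans s B B')

_∣₁_ : ∀ {n m} → Matrix n m → BVec n → Matrix n (m + 1)
A ∣₁ x = A ++ [ x ]

_∣*_ : ∀ {n m t} → Matrix n m → Vec (BVec n) t → Matrix n (m + t)
A ∣* xs = A ++ xs

-- A base of A is the same thing as a spanning set of R(A) vectors, and spanning is
-- transitive: combining combinations of the columns gives a combination whose result is
-- 0/1, and over ℕ its coefficients may then be capped at 1.
-- If R(A | x) = R(A), a base of (A | x) is a base of A that spans x; a base B spanning all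
-- bases therefore spans every such x, so B still spans (A | x₁, …, x_t).
-- Conversely, append every vector occurring in some base of A. Each one alone keeps the
-- rank, but a base of size R(A) of the augmented matrix would be a base of A spanning
-- every base vector, i.e. a base spanning all bases.

module Submission where

open import Defs
open import Level using (0ℓ)
open import Algebra.Bundles using (Semiring; CommutativeSemiring)
open import Data.Nat using (ℕ; zero; suc; _≤_; _<_; z≤n; s≤s)
open import Data.Nat.Properties using (+-*-semiring; *-zeroʳ; ≤-trans; ≤-antisym; m≤m+n; m+n≤o⇒n≤o; ≤∧≢⇒<)
  renaming (_≟_ to _≟ℕ_)
open import Data.Bool using (Bool; true; false; if_then_else_; _∧_; _∨_)
open import Data.Bool.Properties using (∨-∧-commutativeSemiring) renaming (_≟_ to _≟𝔹_)
open import Data.Fin using (Fin; zero; suc)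
open import Data.Fin.Subset using (⁅_⁆; ⊥)
import Data.Fin.Properties as Fin
open import Data.List using (List; []; _∷_; [_]; cartesianProductWith; filter)
open import Data.List.Membership.Propositional using (lose) renaming (_∈_ to _∈ₗ_)
open import Data.List.Membership.Propositional.Properties using (∈-cartesianProductWith⁺; ∈-filter⁺)
open import Data.List.Relation.Unary.Any using (here; there; any?; satisfied)
open import Data.List.Relation.Unary.All.Properties using (all-filter)
open import Data.Vec using (Vec; []; _∷_; lookup; map; replicate; zipWith; tabulate; fromList; _++_)
open import Data.Vec.Properties
  using (lookup-map; lookup-zipWith; lookup-replicate; map-replicate; map-cong; map-id;
         tabulate∘lookup; tabulate-cong; lookup∘tabulate; ≡-dec)
import Data.Vec.Relation.Unary.All as All
open import Data.Vec.Relation.Unary.All.Properties using (lookup⁺; lookup⁻; ++⁺; ++⁻; fromList⁺)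
open import Data.Vec.Membership.Propositional.Properties using (∈-fromList⁺)
open import Data.Product using (Σ; ∃; _×_; _,_; proj₁; proj₂)
open import Function using (id; _∘_; _⇔_; mk⇔; Equivalence)
open import Relation.Nullary using (¬_; Dec)
open import Relation.Nullary.Decidable using (_×-dec_) renaming (map′ to Dec-map′)
open import Relation.Unary using (Decidable)
open import Relation.Binary.PropositionalEquality
  using (_≡_; _≗_; refl; sym; trans; cong; cong₂; subst; module ≡-Reasoning)

module LinearCombination {c ℓ} (R : Semiring c ℓ) where
  open Semiring R
    using (Carrier; _≈_; _+_; _*_; 0#; 1#; setoid; +-cong; +-congʳ; *-congˡ; +-identityˡ; +-identityʳ;
           *-identityˡ; *-assoc; zeroˡ; zeroʳ; distribˡ; distribʳ; +-commutativeSemigroup)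
    renaming (refl to ≈-refl; sym to ≈-sym)
  open import Algebra.Properties.CommutativeSemigroup +-commutativeSemigroup using (interchange)
  open import Relation.Binary.Reasoning.Setoid setoid

  ⟦_⟧ : Bool → Carrier
  ⟦ b ⟧ = if b then 1# else 0#

  comb : ∀ {n k} → Vec (BVec n) k → Vec Carrier k → Fin n → Carrier
  comb []      []       p = 0#
  comb (x ∷ X) (e ∷ es) p = e * ⟦ lookup x p ⟧ + comb X es p

  IsCombination : ∀ {n k} → Vec (BVec n) k → Vec Carrier k → BVec n → Set ℓ
  IsCombination X e y = ∀ p → comb X e p ≈ ⟦ lookup y p ⟧

  comb-zeros : ∀ {n k} (X : Vec (BVec n) k) p → comb X (replicate k 0#) p ≈ 0#
  comb-zeros []      p = ≈-refl
  comb-zeros (x ∷ X) p = begin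
    0# * ⟦ lookup x p ⟧ + comb X (replicate _ 0#) p ≈⟨ +-cong (zeroˡ _) (comb-zeros X p) ⟩
    0# + 0#                                        ≈⟨ +-identityˡ 0# ⟩
    0#                                             ∎

  comb-+ : ∀ {n k} (X : Vec (BVec n) k) e f p →
           comb X (zipWith _+_ e f) p ≈ comb X e p + comb X f p
  comb-+ []      []       []       p = ≈-sym (+-identityˡ 0#)
  comb-+ (x ∷ X) (e ∷ es) (f ∷ fs) p = begin
    (e + f) * b + comb X (zipWith _+_ es fs) p    ≈⟨ +-cong (distribʳ b e f) (comb-+ X es fs p) ⟩
    (e * b + f * b) + (comb X es p + comb X fs p) ≈⟨ interchange _ _ _ _ ⟩
    (e * b + comb X es p) + (f * b + comb X fs p) ∎
    where b = ⟦ lookup x p ⟧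

  comb-* : ∀ {n k} (X : Vec (BVec n) k) a e p → comb X (map (a *_) e) p ≈ a * comb X e p
  comb-* []      a []       p = ≈-sym (zeroʳ a)
  comb-* (x ∷ X) a (e ∷ es) p = begin
    a * e * b + comb X (map (a *_) es) p ≈⟨ +-cong (*-assoc a e b) (comb-* X a es p) ⟩
    a * (e * b) + a * comb X es p        ≈⟨ distribˡ a _ _ ⟨
    a * (e * b + comb X es p)            ∎
    where b = ⟦ lookup x p ⟧

  comb-⁅⁆ : ∀ {n k} (X : Vec (BVec n) k) j → IsCombination X (map ⟦_⟧ ⁅ j ⁆) (lookup X j)
  comb-⁅⁆ (x ∷ X) zero p = begin
    1# * ⟦ lookup x p ⟧ + comb X (map ⟦_⟧ ⊥) p
      ≡⟨ cong (λ e → 1# * ⟦ lookup x p ⟧ + comb X e p) (map-replicate ⟦_⟧ false _) ⟩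
    1# * ⟦ lookup x p ⟧ + comb X (replicate _ 0#) p ≈⟨ +-cong (*-identityˡ _) (comb-zeros X p) ⟩
    ⟦ lookup x p ⟧ + 0#                            ≈⟨ +-identityʳ _ ⟩
    ⟦ lookup x p ⟧                                 ∎
  comb-⁅⁆ (x ∷ X) (suc j) p = begin
    0# * ⟦ lookup x p ⟧ + comb X (map ⟦_⟧ ⁅ j ⁆) p ≈⟨ +-cong (zeroˡ _) (comb-⁅⁆ X j p) ⟩
    0# + ⟦ lookup (lookup X j) p ⟧                  ≈⟨ +-identityˡ _ ⟩
    ⟦ lookup (lookup X j) p ⟧                       ∎

  combineRows : ∀ {k k'} → (Fin k' → Vec Carrier k) → Vec Carrier k' → Vec Carrier k
  combineRows D []       = replicate _ 0#
  combineRows D (c ∷ cs) = zipWith _+_ (map (c *_) (D zero)) (combineRows (D ∘ suc) cs)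

  comb-combineRows : ∀ {n k k'} (X : Vec (BVec n) k) (Y : Vec (BVec n) k') D →
    (∀ j → IsCombination X (D j) (lookup Y j)) →
    ∀ c p → comb X (combineRows D c) p ≈ comb Y c p
  comb-combineRows X []      D XD=Y []       p = comb-zeros X p
  comb-combineRows X (y ∷ Y) D XD=Y (c ∷ cs) p = begin
    comb X (zipWith _+_ (map (c *_) (D zero)) (combineRows (D ∘ suc) cs)) p
      ≈⟨ comb-+ X _ _ p ⟩
    comb X (map (c *_) (D zero)) p + comb X (combineRows (D ∘ suc) cs) p
      ≈⟨ +-cong (comb-* X c (D zero) p) (comb-combineRows X Y (D ∘ suc) (XD=Y ∘ suc) cs p) ⟩
    c * comb X (D zero) p + comb Y cs p
      ≈⟨ +-congʳ (*-congˡ (XD=Y zero p)) ⟩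
    c * ⟦ lookup y p ⟧ + comb Y cs p                         ∎

Exhaustive : {A : Set} → List A → Set
Exhaustive L = ∀ a → a ∈ₗ L

search : {A : Set} {P : A → Set} {L : List A} → Exhaustive L → Decidable P → Dec (∃ P)
search {L = L} L-exhaustive P? = Dec-map′ satisfied (λ (a , Pa) → lose (L-exhaustive a) Pa) (any? P? L)

vectors : {A : Set} → List A → ∀ k → List (Vec A k)
vectors L zero    = [ [] ]
vectors L (suc k) = cartesianProductWith _∷_ L (vectors L k)

vectors-exhaustive : {A : Set} {L : List A} → Exhaustive L → ∀ {k} → Exhaustive (vectors L k)
vectors-exhaustive L-exhaustive []      = here refl
vectors-exhaustive L-exhaustive (a ∷ v) =
  ∈-cartesianProductWith⁺ _∷_ (L-exhaustive a) (vectors-exhaustive L-exhaustive v)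

bitVectors : ∀ n → List (BVec n)
bitVectors = vectors (true ∷ false ∷ [])

bitVectors-exhaustive : ∀ {n} → Exhaustive (bitVectors n)
bitVectors-exhaustive = vectors-exhaustive λ { true → here refl ; false → there (here refl) }

open import Data.Nat using (_+_; _*_)

-- Both settings are combinations over a semiring, with the entries of the 0/1 vectors
-- read as 0# and 1#: ℕ for the binary setting and (Bool, ∨, ∧) for the boolean one.
semiring : Setting → Semiring 0ℓ 0ℓ
semiring binary  = +-*-semiring
semiring boolean = CommutativeSemiring.semiring ∨-∧-commutativeSemiring

module SettingCombination (s : Setting) = LinearCombination (semiring s)
open SettingCombination using (IsCombination)

private module ℕ-LC = LinearCombination (semiring binary)
private module 𝔹-LC = LinearCombination (semiring boolean)

≡⇔lookup≗ : ∀ {A : Set} {n} {u v : Vec A n} {f g : Fin n → A} →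
            lookup u ≗ f → lookup v ≗ g → (u ≡ v ⇔ f ≗ g)
≡⇔lookup≗ {u = u} {v} u≗f v≗g = mk⇔
  (λ { refl p → trans (sym (u≗f p)) (v≗g p) })
  (λ f≗g → begin
    u                        ≡⟨ tabulate∘lookup u ⟨
    tabulate (lookup u)      ≡⟨ tabulate-cong (λ p → trans (u≗f p) (trans (f≗g p) (sym (v≗g p)))) ⟩
    tabulate (lookup v)      ≡⟨ tabulate∘lookup v ⟩
    v                        ∎)
  where open ≡-Reasoning

bool→ℕ≗⟦⟧ : bool→ℕ ≗ ℕ-LC.⟦_⟧
bool→ℕ≗⟦⟧ false = refl
bool→ℕ≗⟦⟧ true  = refl

combℕ-entry : ∀ {n k} (X : Vec (BVec n) k) c → lookup (combℕ X c) ≗ ℕ-LC.comb X (map ℕ-LC.⟦_⟧ c)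
combℕ-entry []      []       p = lookup-replicate p 0
combℕ-entry (x ∷ X) (c ∷ cs) p =
  trans (lookup-zipWith _+_ p (map (λ b → bool→ℕ (c ∧ b)) x) (combℕ X cs))
        (cong₂ _+_ (trans (lookup-map p _ x) (∧-entry c (lookup x p))) (combℕ-entry X cs p))
  where
  ∧-entry : ∀ a b → bool→ℕ (a ∧ b) ≡ ℕ-LC.⟦ a ⟧ * ℕ-LC.⟦ b ⟧
  ∧-entry false b     = refl
  ∧-entry true  false = refl
  ∧-entry true  true  = refl

⟦⟧-𝔹 : 𝔹-LC.⟦_⟧ ≗ id
⟦⟧-𝔹 false = refl
⟦⟧-𝔹 true  = refl

combB-entry : ∀ {n k} (X : Vec (BVec n) k) c → lookup (combB X c) ≗ 𝔹-LC.comb X (map 𝔹-LC.⟦_⟧ c)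
combB-entry []      []       p = lookup-replicate p false
combB-entry (x ∷ X) (c ∷ cs) p =
  trans (lookup-zipWith _∨_ p (map (c ∧_) x) (combB X cs))
        (cong₂ _∨_ (trans (lookup-map p _ x) (∧-entry c (lookup x p))) (combB-entry X cs p))
  where
  ∧-entry : ∀ a b → a ∧ b ≡ 𝔹-LC.⟦ a ⟧ ∧ 𝔹-LC.⟦ b ⟧
  ∧-entry false b = refl
  ∧-entry true  b = sym (⟦⟧-𝔹 b)

represents⇔ : ∀ s {n k} (X : Vec (BVec n) k) c y →
              Represents s X c y ⇔ IsCombination s X (map (SettingCombination.⟦_⟧ s) c) y
represents⇔ binary  X c y =
  ≡⇔lookup≗ (combℕ-entry X c) (λ p → trans (lookup-map p bool→ℕ y) (bool→ℕ≗⟦⟧ _))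
represents⇔ boolean X c y =
  ≡⇔lookup≗ (combB-entry X c) (λ p → sym (⟦⟧-𝔹 _))

isPositive : ℕ → Bool
isPositive zero    = false
isPositive (suc _) = true

⟦⟧≤1 : ∀ b → ℕ-LC.⟦ b ⟧ ≤ 1
⟦⟧≤1 false = z≤n
⟦⟧≤1 true  = s≤s z≤n

-- Where a combination over ℕ is at most 1, a coefficient ≥ 2 can only meet 0 entries,
-- so capping the coefficients at 1 changes nothing.
comb-capped : ∀ {n k} (X : Vec (BVec n) k) e p → ℕ-LC.comb X e p ≤ 1 →
              ℕ-LC.comb X (map ℕ-LC.⟦_⟧ (map isPositive e)) p ≡ ℕ-LC.comb X e p
comb-capped []      []       p _ = refl
comb-capped (x ∷ X) (e ∷ es) p ≤1 =
  cong₂ _+_ (capped-term e (lookup x p) (≤-trans (m≤m+n _ _) ≤1))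
            (comb-capped X es p (m+n≤o⇒n≤o (e * ℕ-LC.⟦ lookup x p ⟧) ≤1))
  where
  capped-term : ∀ e b → e * ℕ-LC.⟦ b ⟧ ≤ 1 →
                ℕ-LC.⟦ isPositive e ⟧ * ℕ-LC.⟦ b ⟧ ≡ e * ℕ-LC.⟦ b ⟧
  capped-term zero          b     _         = refl
  capped-term (suc e)       false _         = sym (*-zeroʳ e)
  capped-term (suc zero)    true  _         = refl
  capped-term (suc (suc e)) true  (s≤s ())

isCombination⇒spansVec : ∀ s {n k} (X : Vec (BVec n) k) e y → IsCombination s X e y → SpansVec s X y
isCombination⇒spansVec binary X e y Xe=y =
  map isPositive e , Equivalence.from (represents⇔ binary X _ y)
    (λ p → trans (comb-capped X e p (subst (_≤ 1) (sym (Xe=y p)) (⟦⟧≤1 (lookup y p)))) (Xe=y p))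
isCombination⇒spansVec boolean X e y Xe=y =
  e , Equivalence.from (represents⇔ boolean X e y)
    (subst (λ c → IsCombination boolean X c y) (sym (trans (map-cong ⟦⟧-𝔹 e) (map-id e))) Xe=y)

represents? : ∀ s {n k} (X : Vec (BVec n) k) c y → Dec (Represents s X c y)
represents? binary  X c y = ≡-dec _≟ℕ_ (combℕ X c) (map bool→ℕ y)
represents? boolean X c y = ≡-dec _≟𝔹_ (combB X c) y

module _ (s : Setting) where
  open SettingCombination s using (⟦_⟧; comb; combineRows; comb-combineRows; comb-⁅⁆)
  open Semiring (semiring s) using (setoid)
  open import Relation.Binary.Reasoning.Setoid setoid

  lookup-spansVec : ∀ {n k} (X : Vec (BVec n) k) j → SpansVec s X (lookup X j)
  lookup-spansVec X j = ⁅ j ⁆ , Equivalence.from (represents⇔ s X ⁅ j ⁆ (lookup X j)) (comb-⁅⁆ X j)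

  spansVec-trans : ∀ {n k k'} {X : Vec (BVec n) k} {Y : Vec (BVec n) k'} {y} →
                   Spans s X Y → SpansVec s Y y → SpansVec s X y
  spansVec-trans {X = X} {Y} {y} X⊢Y (c , Yc≡y) =
    isCombination⇒spansVec s X (combineRows D (map ⟦_⟧ c)) y λ p → begin
      comb X (combineRows D (map ⟦_⟧ c)) p ≈⟨ comb-combineRows X Y D XD=Y (map ⟦_⟧ c) p ⟩
      comb Y (map ⟦_⟧ c) p                 ≈⟨ Equivalence.to (represents⇔ s Y c y) Yc≡y p ⟩
      ⟦ lookup y p ⟧                       ∎
    where
    D = λ j → map ⟦_⟧ (proj₁ (X⊢Y j))
    XD=Y : ∀ j → IsCombination s X (D j) (lookup Y j)
    XD=Y j = Equivalence.to (represents⇔ s X _ _) (proj₂ (X⊢Y j))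

  spans-++ : ∀ {n k m t} {U : Vec (BVec n) k} (A : Matrix n m) (xs : Vec (BVec n) t) →
             Spans s U A → Spans s U xs → Spans s U (A ++ xs)
  spans-++ {U = U} A xs U⊢A U⊢xs =
    lookup⁺ (++⁺ {P = SpansVec s U} {xs = A} {ys = xs} (lookup⁻ U⊢A) (lookup⁻ U⊢xs))

  spans-++ˡ : ∀ {n k m t} {U : Vec (BVec n) k} (A : Matrix n m) (xs : Vec (BVec n) t) →
              Spans s U (A ++ xs) → Spans s U A
  spans-++ˡ {U = U} A xs U⊢A++xs = lookup⁺ (proj₁ (++⁻ {P = SpansVec s U} A (lookup⁻ U⊢A++xs)))

  spans-++ʳ : ∀ {n k m t} {U : Vec (BVec n) k} (A : Matrix n m) (xs : Vec (BVec n) t) →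
              Spans s U (A ++ xs) → Spans s U xs
  spans-++ʳ {U = U} A xs U⊢A++xs = lookup⁺ (proj₂ (++⁻ {P = SpansVec s U} A (lookup⁻ U⊢A++xs)))

  factorizes⇒spans : ∀ {n m k} (A : Matrix n m) → Factorizes s A k → Σ (Matrix n k) λ U → Spans s U A
  factorizes⇒spans A (U , V , UV≡A) = U , λ j → lookup V j , UV≡A j

  spans⇒factorizes : ∀ {n m k} (A : Matrix n m) (U : Matrix n k) → Spans s U A → Factorizes s A k
  spans⇒factorizes A U U⊢A = U , V , λ j →
    subst (λ c → Represents s U c (lookup A j)) (sym (lookup∘tabulate (proj₁ ∘ U⊢A) j)) (proj₂ (U⊢A j))
    where V = tabulate (proj₁ ∘ U⊢A)

  rank≤size : ∀ {n m k k'} (A : Matrix n m) → HasRank s A k → (U : Matrix n k') → Spans s U A → k ≤ k'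
  rank≤size A (_ , minimal) U U⊢A = minimal _ (spans⇒factorizes A U U⊢A)

  rank≤rank-++ : ∀ {n m t k r} (A : Matrix n m) (xs : Vec (BVec n) t) →
                 HasRank s A k → Factorizes s (A ++ xs) r → k ≤ r
  rank≤rank-++ A xs rank-k F with factorizes⇒spans (A ++ xs) F
  ... | U , U⊢A++xs = rank≤size A rank-k U (spans-++ˡ A xs U⊢A++xs)

  hasRank-++ : ∀ {n m t k} (A : Matrix n m) (xs : Vec (BVec n) t) → HasRank s A k →
               (U : Matrix n k) → Spans s U (A ++ xs) → HasRank s (A ++ xs) k
  hasRank-++ A xs rank-k U U⊢A++xs = spans⇒factorizes (A ++ xs) U U⊢A++xs , λ _ → rank≤rank-++ A xs rank-k

  isBase-of-rank : ∀ {n m k} (A : Matrix n m) → HasRank s A k → (U : Matrix n k) → Spans s U A → IsBase s A U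
  isBase-of-rank A rank-k U U⊢A = U⊢A , λ k' B → rank≤size A rank-k B

  base-size≡rank : ∀ {n m k k'} (A : Matrix n m) → HasRank s A k → (B : Matrix n k') → IsBase s A B → k' ≡ k
  base-size≡rank A rank-k@(F , _) B (B⊢A , B-minimal) with factorizes⇒spans A F
  ... | U , U⊢A = ≤-antisym (B-minimal _ U U⊢A) (rank≤size A rank-k B B⊢A)

  augmentation : ∀ {n m k t} (A : Matrix n m) → HasRank s A k → HasUniversalBase s A →
                 (xs : Vec (BVec n) t) → (∀ i → HasRank s (A ∣₁ lookup xs i) k) → HasRank s (A ∣* xs) k
  augmentation A rank-k (_ , B , B-base@(B⊢A , _) , B-universal) xs rank-A∣x
    with base-size≡rank A rank-k B B-base
  ... | refl = hasRank-++ A xs rank-k B (spans-++ A xs B⊢A B⊢xs)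
    where
    B⊢xs : Spans s B xs
    B⊢xs i with factorizes⇒spans (A ∣₁ lookup xs i) (proj₁ (rank-A∣x i))
    ... | U , U⊢A∣x = spansVec-trans (B-universal _ U (isBase-of-rank A rank-k U (spans-++ˡ A _ U⊢A∣x)))
                                     (spans-++ʳ A _ U⊢A∣x zero)

  InSpanningSetOfSize : ∀ {n m} → Matrix n m → ℕ → BVec n → Set
  InSpanningSetOfSize {n} A k v = Σ (Matrix n k) λ B → Spans s B A × Σ (Fin k) λ j → lookup B j ≡ v

  inSpanningSetOfSize? : ∀ {n m} (A : Matrix n m) k → Decidable (InSpanningSetOfSize A k)
  inSpanningSetOfSize? A k v =
    search (vectors-exhaustive bitVectors-exhaustive) λ B →
      spans? B A ×-dec Fin.any? (λ j → ≡-dec _≟𝔹_ (lookup B j) v)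
    where
    spans? : ∀ {n k m} (X : Vec (BVec n) k) (Y : Vec (BVec n) m) → Dec (Spans s X Y)
    spans? X Y = Fin.all? λ j → search bitVectors-exhaustive λ c → represents? s X c (lookup Y j)

  hasRank-∣₁ : ∀ {n m k} (A : Matrix n m) {v} → HasRank s A k →
               InSpanningSetOfSize A k v → HasRank s (A ∣₁ v) k
  hasRank-∣₁ A rank-k (B , B⊢A , j , refl) =
    hasRank-++ A _ rank-k B (spans-++ A _ B⊢A λ { zero → lookup-spansVec B j })

  universalBase : ∀ {n m k} (A : Matrix n m) → HasRank s A k → (U : Matrix n k) → Spans s U A →
                  (∀ v → InSpanningSetOfSize A k v → SpansVec s U v) → HasUniversalBase s A
  universalBase A rank-k U U⊢A U⊢base-vectors = _ , U , isBase-of-rank A rank-k U U⊢A , U⊢bases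
    where
    U⊢bases : ∀ k' (B : Matrix _ k') → IsBase s A B → Spans s U B
    U⊢bases k' B B-base@(B⊢A , _) with base-size≡rank A rank-k B B-base
    ... | refl = λ j → U⊢base-vectors _ (B , B⊢A , j , refl)

  non-augmentation : ∀ {n m k} (A : Matrix n m) → HasRank s A k → ¬ HasUniversalBase s A →
    Σ ℕ λ t → Σ (Vec (BVec n) t) λ xs →
      ((i : Fin t) → HasRank s (A ∣₁ lookup xs i) k) × ((r : ℕ) → HasRank s (A ∣* xs) r → k < r)
  non-augmentation {n} {k = k} A rank-k no-universal-base = _ , xs , rank-A∣x , rank-A∣xs
    where
    xs = fromList (filter (inSpanningSetOfSize? A k) (bitVectors n))
    in-base : All.All (InSpanningSetOfSize A k) xs
    in-base = fromList⁺ (all-filter (inSpanningSetOfSize? A k) (bitVectors n))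
    rank-A∣x : ∀ i → HasRank s (A ∣₁ lookup xs i) k
    rank-A∣x i = hasRank-∣₁ A rank-k (lookup⁺ in-base i)
    universal : Factorizes s (A ∣* xs) k → HasUniversalBase s A
    universal F with factorizes⇒spans (A ∣* xs) F
    ... | U , U⊢A++xs = universalBase A rank-k U (spans-++ˡ A xs U⊢A++xs) λ v v-in-base →
      All.lookup (lookup⁻ {P = SpansVec s U} (spans-++ʳ A xs U⊢A++xs))
                 (∈-fromList⁺ (∈-filter⁺ (inSpanningSetOfSize? A k) (bitVectors-exhaustive v) v-in-base))
    rank-A∣xs : ∀ r → HasRank s (A ∣* xs) r → k < r
    rank-A∣xs r (F , _) =
      ≤∧≢⇒< (rank≤rank-++ A xs rank-k F) λ { refl → no-universal-base (universal F) }

theorem1 : (s : Setting) (n m : ℕ) (A : Matrix n m) (k : ℕ) → HasRank s A k →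
    (HasUniversalBase s A →
      (t : ℕ) (xs : Vec (BVec n) t) →
      ((i : Fin t) → HasRank s (A ∣₁ lookup xs i) k) →
      HasRank s (A ∣* xs) k)
    ×
    ((¬ HasUniversalBase s A) →
      Σ ℕ λ t → Σ (Vec (BVec n) t) λ xs →
        ((i : Fin t) → HasRank s (A ∣₁ lookup xs i) k) ×
        ((r : ℕ) → HasRank s (A ∣* xs) r → k < r))
theorem1 s n m A k rank-k =
  (λ universal _ → augmentation s A rank-k universal) , non-augmentation s A rank-k
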